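{- For integers $n,\lambda_1,\nu_1\ge0$, define $$f(n;\lambda_1,\nu_1)=\sum_{\mu_1\ge0}t^{ -(\mu_1+n)(\lambda_1+\nu_1-\mu_1+n)}\,(t^{1+\lambda_1-\mu_1};t)_{\mu_1}\begin{bmatrix}\nu_1\\ \mu_1\end{bmatrix}_t.$$ Then $f(n;\lambda_1,\nu_1)=t^{ -(\lambda_1+n)(\nu_1+n)}$.
   Context: $t$ is an indeterminate (identities are in $\mathbb{Q}(t)$). $(a;t)_k=\prod_{l=0}^{k-1}(1-at^l)$ with $(a;t)_0=1$. For $N\in\mathbb{Z}$ and $m\ge0$, the $t$-binomial is $\begin{bmatrix}N\\ m\end{bmatrix}_t=\frac{(1-t^{N-m+1})\cdots(1-t^{N})}{(1-t)\cdots(1-t^m)}$ (equal to $1$ for $m=0$, and $0$ when $0\le N<m$), so the sum defining $f$ is finite. -}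

module Defs where

open import Data.Nat as ℕ using (ℕ; zero; suc)
open import Data.Integer as ℤ using (ℤ; +_; -[1+_])
open import Data.List using (List; []; _∷_; map; replicate; _++_)
open import Relation.Binary.PropositionalEquality using (_≡_)

-- The field ℚ(t) is realised as the field of fractions of ℤ[t]
-- (which is ℚ(t)): polynomials are coefficient lists (lowest degree first),
-- rational functions are formal quotients num / den, and equality of
-- rational functions is cross-multiplication equality of polynomials.

Poly : Set
Poly = List ℤ

coeff : Poly → ℕ → ℤ
coeff []       _       = + 0
coeff (a ∷ p)  zero    = a
coeff (a ∷ p)  (suc i) = coeff p i

-- equality of polynomials: all coefficients agree (trailing zeros irrelevant)
_≈P_ : Poly → Poly → Set
p ≈P q = ∀ i → coeff p i ≡ coeff q i

infixl 6 _+P_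
infixl 7 _*P_

_+P_ : Poly → Poly → Poly
[]      +P q       = q
(a ∷ p) +P []      = a ∷ p
(a ∷ p) +P (b ∷ q) = (a ℤ.+ b) ∷ (p +P q)

_*P_ : Poly → Poly → Poly
[]      *P q = []
(a ∷ p) *P q = map (a ℤ.*_) q +P (+ 0 ∷ (p *P q))

-P_ : Poly → Poly
-P p = map ℤ.-_ p

constP : ℤ → Poly
constP a = a ∷ []

XP : ℕ → Poly
XP k = replicate k (+ 0) ++ (+ 1 ∷ [])

record RatFun : Set where
  constructor _/ᵣ_
  field
    num : Poly
    den : Poly
open RatFun public

infix 4 _≈_
_≈_ : RatFun → RatFun → Set
f ≈ g = (num f *P den g) ≈P (num g *P den f)

infixl 6 _+ᵣ_ _-ᵣ_
infixl 7 _*ᵣ_ _÷ᵣ_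

0ᵣ 1ᵣ : RatFun
0ᵣ = [] /ᵣ constP (+ 1)
1ᵣ = constP (+ 1) /ᵣ constP (+ 1)

_+ᵣ_ : RatFun → RatFun → RatFun
f +ᵣ g = (num f *P den g +P num g *P den f) /ᵣ (den f *P den g)

-ᵣ_ : RatFun → RatFun
-ᵣ f = (-P num f) /ᵣ den f

_-ᵣ_ : RatFun → RatFun → RatFun
f -ᵣ g = f +ᵣ (-ᵣ g)

_*ᵣ_ : RatFun → RatFun → RatFun
f *ᵣ g = (num f *P num g) /ᵣ (den f *P den g)

-- division (only applied to nonzero divisors below)
_÷ᵣ_ : RatFun → RatFun → RatFun
f ÷ᵣ g = (num f *P den g) /ᵣ (den f *P num g)

tpow : ℤ → RatFun
tpow (+ k)      = XP k /ᵣ constP (+ 1)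
tpow -[1+ k ]   = constP (+ 1) /ᵣ XP (suc k)

sumᵣ : ℕ → (ℕ → RatFun) → RatFun
sumᵣ zero    f = 0ᵣ
sumᵣ (suc n) f = sumᵣ n f +ᵣ f n

prodᵣ : ℕ → (ℕ → RatFun) → RatFun
prodᵣ zero    f = 1ᵣ
prodᵣ (suc n) f = prodᵣ n f *ᵣ f n

tPoch : ℤ → ℕ → RatFun
tPoch e k = prodᵣ k (λ l → 1ᵣ -ᵣ tpow (e ℤ.+ + l))

tBinom : ℤ → ℕ → RatFun
tBinom N m =
  prodᵣ m (λ i → 1ᵣ -ᵣ tpow (N ℤ.- + m ℤ.+ + suc i))
  ÷ᵣ prodᵣ m (λ i → 1ᵣ -ᵣ tpow (+ suc i))

-- f(n; λ₁, ν₁) = Σ_{μ₁ ≥ 0} t^{-(μ₁+n)(λ₁+ν₁-μ₁+n)} (t^{1+λ₁-μ₁};t)_{μ₁} [ν₁ choose μ₁]_t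
-- The terms with μ₁ > ν₁ vanish (the t-binomial is 0 there), so the sum is
-- over μ₁ = 0 .. ν₁.
fTerm : ℕ → ℕ → ℕ → ℕ → RatFun
fTerm n l v m =
  tpow (ℤ.- ((+ m ℤ.+ + n) ℤ.* (+ l ℤ.+ + v ℤ.- + m ℤ.+ + n)))
  *ᵣ tPoch (+ 1 ℤ.+ + l ℤ.- + m) m
  *ᵣ tBinom (+ v) m

f : ℕ → ℕ → ℕ → RatFun
f n l v = sumᵣ (suc v) (fTerm n l v)

-- Write the exponent as -(μ+n)(λ+ν-μ+n) = -(λ+n)(ν+n) + (λ-μ)(ν-μ); it then suffices to show
--   Σ_μ t^((λ-μ)(ν-μ)) (t^(1+λ-μ);t)_μ [ν μ]_t = 1,
-- by induction on ν. The t-Pascal rule [ν+1, μ+1] = t^(ν-μ) [ν, μ] + [ν, μ+1] splits each term of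
-- the sum for ν+1 into two pieces α and β; since (t^(λ-μ);t)_(μ+1) = (1 - t^(λ-μ)) (t^(1+λ-μ);t)_μ,
-- the pieces with the same [ν, μ] recombine, via (1 - t^(λ-μ)) + t^(λ-μ) = 1, into the μ-th term of
-- the sum for ν, while the leftover [ν, ν+1] vanishes.

module Submission where

open import Defs
open import Data.Nat as ℕ using (ℕ; zero; suc)
open import Data.Integer using (ℤ; +_; -[1+_]; -_; _+_; _-_; _*_)
import Data.Integer.Properties as ℤ
open import Data.Integer.Tactic.RingSolver renaming (solve-∀ to ℤ-solve-∀)
open import Data.List using ([]; _∷_; map)
open import Data.Maybe using (Maybe; just; nothing)
open import Data.Product using (∃₂; _,_)
open import Data.Sum using (inj₁; inj₂)
open import Data.Empty using (⊥-elim; ⊥-elim-irr)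
open import Relation.Nullary using (¬_; yes; no)
open import Relation.Binary.PropositionalEquality using (_≡_; _≢_; refl; sym; trans; cong; cong₂; module ≡-Reasoning)
open import Algebra.Bundles using (CommutativeRing)
open import Level using (0ℓ)
open import Function using (_∘_)
import Relation.Binary.Reasoning.Setoid as SetoidReasoning
open import Tactic.RingSolver using (solve-∀)
open import Tactic.RingSolver.Core.AlmostCommutativeRing using (AlmostCommutativeRing; fromCommutativeRing)

-- Polynomials

-- Wrapping _≈P_ in a record lets Agda infer p and q from a proof of p ≋ q.
infix 4 _≋_
record _≋_ (p q : Poly) : Set where
  constructor mk≋
  field coeff-≡ : p ≈P q
open _≋_

≋-refl : ∀ {p} → p ≋ p
≋-refl = mk≋ λ _ → refl

≋-sym : ∀ {p q} → p ≋ q → q ≋ p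
≋-sym h = mk≋ λ i → sym (coeff-≡ h i)

≋-trans : ∀ {p q r} → p ≋ q → q ≋ r → p ≋ r
≋-trans h k = mk≋ λ i → trans (coeff-≡ h i) (coeff-≡ k i)

≡⇒≋ : ∀ {p q} → p ≡ q → p ≋ q
≡⇒≋ refl = ≋-refl

scaleP : ℤ → Poly → Poly
scaleP a = map (a *_)

coeff-+P : ∀ p q i → coeff (p +P q) i ≡ coeff p i + coeff q i
coeff-+P []      q       i       = sym (ℤ.+-identityˡ _)
coeff-+P (a ∷ p) []      i       = sym (ℤ.+-identityʳ _)
coeff-+P (a ∷ p) (b ∷ q) zero    = refl
coeff-+P (a ∷ p) (b ∷ q) (suc i) = coeff-+P p q i

coeff-scaleP : ∀ a q i → coeff (scaleP a q) i ≡ a * coeff q i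
coeff-scaleP a []      i       = sym (ℤ.*-zeroʳ a)
coeff-scaleP a (b ∷ q) zero    = refl
coeff-scaleP a (b ∷ q) (suc i) = coeff-scaleP a q i

coeff--P : ∀ p i → coeff (-P p) i ≡ - coeff p i
coeff--P []      i       = refl
coeff--P (a ∷ p) zero    = refl
coeff--P (a ∷ p) (suc i) = coeff--P p i

∷-cong : ∀ {a b p q} → a ≡ b → p ≋ q → (a ∷ p) ≋ (b ∷ q)
∷-cong e h = mk≋ λ { zero → e ; (suc i) → coeff-≡ h i }

0∷-≋[] : ∀ {p} → p ≋ [] → (+ 0 ∷ p) ≋ []
0∷-≋[] h = mk≋ λ { zero → refl ; (suc i) → coeff-≡ h i }

tail-≋ : ∀ {a b p q} → (a ∷ p) ≋ (b ∷ q) → p ≋ q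
tail-≋ h = mk≋ λ i → coeff-≡ h (suc i)

tail-≋[] : ∀ {a p} → (a ∷ p) ≋ [] → p ≋ []
tail-≋[] h = mk≋ λ i → coeff-≡ h (suc i)

+P-cong : ∀ {p p′ q q′} → p ≋ p′ → q ≋ q′ → (p +P q) ≋ (p′ +P q′)
+P-cong {p} {p′} {q} {q′} h k = mk≋ λ i →
  trans (coeff-+P p q i) (trans (cong₂ _+_ (coeff-≡ h i) (coeff-≡ k i)) (sym (coeff-+P p′ q′ i)))

+P-comm : ∀ p q → (p +P q) ≋ (q +P p)
+P-comm p q = mk≋ λ i →
  trans (coeff-+P p q i) (trans (ℤ.+-comm (coeff p i) (coeff q i)) (sym (coeff-+P q p i)))

+P-assoc : ∀ p q r → ((p +P q) +P r) ≋ (p +P (q +P r))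
+P-assoc p q r = mk≋ λ i → begin
  coeff ((p +P q) +P r) i              ≡⟨ coeff-+P (p +P q) r i ⟩
  coeff (p +P q) i + coeff r i         ≡⟨ cong (_+ coeff r i) (coeff-+P p q i) ⟩
  coeff p i + coeff q i + coeff r i    ≡⟨ ℤ.+-assoc (coeff p i) (coeff q i) (coeff r i) ⟩
  coeff p i + (coeff q i + coeff r i)  ≡⟨ cong (_+_ (coeff p i)) (coeff-+P q r i) ⟨
  coeff p i + coeff (q +P r) i         ≡⟨ coeff-+P p (q +P r) i ⟨
  coeff (p +P (q +P r)) i              ∎
  where open ≡-Reasoning

+P-interchange : ∀ p q r s → ((p +P q) +P (r +P s)) ≋ ((p +P r) +P (q +P s))
+P-interchange p q r s = mk≋ λ i → begin
  coeff ((p +P q) +P (r +P s)) i                        ≡⟨ expand p q r s i ⟩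
  (coeff p i + coeff q i) + (coeff r i + coeff s i)     ≡⟨ swap (coeff p i) (coeff q i) (coeff r i) (coeff s i) ⟩
  (coeff p i + coeff r i) + (coeff q i + coeff s i)     ≡⟨ expand p r q s i ⟨
  coeff ((p +P r) +P (q +P s)) i                        ∎
  where
  open ≡-Reasoning
  expand : ∀ p q r s i → coeff ((p +P q) +P (r +P s)) i ≡ (coeff p i + coeff q i) + (coeff r i + coeff s i)
  expand p q r s i = trans (coeff-+P (p +P q) (r +P s) i) (cong₂ _+_ (coeff-+P p q i) (coeff-+P r s i))
  swap : ∀ w x y z → (w + x) + (y + z) ≡ (w + y) + (x + z)
  swap = ℤ-solve-∀

+P-identityˡ : ∀ p → ([] +P p) ≋ p
+P-identityˡ p = ≋-refl

+P-identityʳ : ∀ p → (p +P []) ≋ p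
+P-identityʳ p = mk≋ λ i → trans (coeff-+P p [] i) (ℤ.+-identityʳ _)

+P-inverseʳ : ∀ p → (p +P (-P p)) ≋ []
+P-inverseʳ p = mk≋ λ i →
  trans (coeff-+P p (-P p) i) (trans (cong (_+_ (coeff p i)) (coeff--P p i)) (ℤ.+-inverseʳ (coeff p i)))

-P-cong : ∀ {p q} → p ≋ q → (-P p) ≋ (-P q)
-P-cong {p} {q} h = mk≋ λ i → trans (coeff--P p i) (trans (cong -_ (coeff-≡ h i)) (sym (coeff--P q i)))

scaleP-cong : ∀ a {p q} → p ≋ q → scaleP a p ≋ scaleP a q
scaleP-cong a {p} {q} h = mk≋ λ i →
  trans (coeff-scaleP a p i) (trans (cong (a *_) (coeff-≡ h i)) (sym (coeff-scaleP a q i)))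

scaleP-congˡ : ∀ {a b} p → a ≡ b → scaleP a p ≋ scaleP b p
scaleP-congˡ p refl = ≋-refl

scaleP-distribˡ : ∀ a p q → scaleP a (p +P q) ≋ (scaleP a p +P scaleP a q)
scaleP-distribˡ a p q = mk≋ λ i → begin
  coeff (scaleP a (p +P q)) i                  ≡⟨ coeff-scaleP a (p +P q) i ⟩
  a * coeff (p +P q) i                         ≡⟨ cong (a *_) (coeff-+P p q i) ⟩
  a * (coeff p i + coeff q i)                  ≡⟨ ℤ.*-distribˡ-+ a (coeff p i) (coeff q i) ⟩
  a * coeff p i + a * coeff q i                ≡⟨ cong₂ _+_ (coeff-scaleP a p i) (coeff-scaleP a q i) ⟨
  coeff (scaleP a p) i + coeff (scaleP a q) i  ≡⟨ coeff-+P (scaleP a p) (scaleP a q) i ⟨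
  coeff (scaleP a p +P scaleP a q) i           ∎
  where open ≡-Reasoning

scaleP-distribʳ : ∀ a b p → scaleP (a + b) p ≋ (scaleP a p +P scaleP b p)
scaleP-distribʳ a b p = mk≋ λ i → begin
  coeff (scaleP (a + b) p) i                   ≡⟨ coeff-scaleP (a + b) p i ⟩
  (a + b) * coeff p i                          ≡⟨ ℤ.*-distribʳ-+ (coeff p i) a b ⟩
  a * coeff p i + b * coeff p i                ≡⟨ cong₂ _+_ (coeff-scaleP a p i) (coeff-scaleP b p i) ⟨
  coeff (scaleP a p) i + coeff (scaleP b p) i  ≡⟨ coeff-+P (scaleP a p) (scaleP b p) i ⟨
  coeff (scaleP a p +P scaleP b p) i           ∎
  where open ≡-Reasoning

scaleP-assoc : ∀ a b p → scaleP a (scaleP b p) ≋ scaleP (a * b) p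
scaleP-assoc a b p = mk≋ λ i →
  trans (coeff-scaleP a (scaleP b p) i) (trans (cong (a *_) (coeff-scaleP b p i))
    (trans (sym (ℤ.*-assoc a b _)) (sym (coeff-scaleP (a * b) p i))))

scaleP-zero : ∀ p → scaleP (+ 0) p ≋ []
scaleP-zero p = mk≋ (coeff-scaleP (+ 0) p)

scaleP-identity : ∀ p → scaleP (+ 1) p ≋ p
scaleP-identity p = mk≋ λ i → trans (coeff-scaleP (+ 1) p i) (ℤ.*-identityˡ _)

*P-zeroˡ : ∀ p q → p ≋ [] → (p *P q) ≋ []
*P-zeroˡ []      q h = ≋-refl
*P-zeroˡ (a ∷ p) q h = +P-cong
  (≋-trans (scaleP-congˡ q (coeff-≡ h 0)) (scaleP-zero q)) (0∷-≋[] (*P-zeroˡ p q (tail-≋[] h)))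

*P-zeroʳ : ∀ p → (p *P []) ≋ []
*P-zeroʳ []      = ≋-refl
*P-zeroʳ (a ∷ p) = 0∷-≋[] (*P-zeroʳ p)

*P-congˡ : ∀ {p p′} q → p ≋ p′ → (p *P q) ≋ (p′ *P q)
*P-congˡ {[]}    {p′}     q h = ≋-sym (*P-zeroˡ p′ q (≋-sym h))
*P-congˡ {a ∷ p} {[]}     q h = *P-zeroˡ (a ∷ p) q h
*P-congˡ {a ∷ p} {b ∷ p′} q h =
  +P-cong (scaleP-congˡ q (coeff-≡ h 0)) (∷-cong refl (*P-congˡ q (tail-≋ h)))

*P-congʳ : ∀ p {q q′} → q ≋ q′ → (p *P q) ≋ (p *P q′)
*P-congʳ []      h = ≋-refl
*P-congʳ (a ∷ p) h = +P-cong (scaleP-cong a h) (∷-cong refl (*P-congʳ p h))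

*P-cong : ∀ {p p′ q q′} → p ≋ p′ → q ≋ q′ → (p *P q) ≋ (p′ *P q′)
*P-cong {p′ = p′} {q} h k = ≋-trans (*P-congˡ q h) (*P-congʳ p′ k)

-- Below, +P-interchange [] is left commutativity, as [] +P p reduces to p.
*P-∷ʳ : ∀ p b q → (p *P (b ∷ q)) ≋ (scaleP b p +P (+ 0 ∷ (p *P q)))
*P-∷ʳ []      b q = ≋-sym (0∷-≋[] ≋-refl)
*P-∷ʳ (a ∷ p) b q = ∷-cong (cong (_+ + 0) (ℤ.*-comm a b))
  (≋-trans (+P-cong (≋-refl {scaleP a q}) (*P-∷ʳ p b q)) (+P-interchange [] (scaleP a q) (scaleP b p) _))

*P-comm : ∀ p q → (p *P q) ≋ (q *P p)
*P-comm []      q = ≋-sym (*P-zeroʳ q)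
*P-comm (a ∷ p) q =
  ≋-trans (+P-cong (≋-refl {scaleP a q}) (∷-cong refl (*P-comm p q))) (≋-sym (*P-∷ʳ q a p))

*P-distribʳ : ∀ r p q → ((p +P q) *P r) ≋ ((p *P r) +P (q *P r))
*P-distribʳ r []      q       = ≋-refl
*P-distribʳ r (a ∷ p) []      = ≋-sym (+P-identityʳ _)
*P-distribʳ r (a ∷ p) (b ∷ q) =
  ≋-trans (+P-cong (scaleP-distribʳ a b r) (∷-cong refl (*P-distribʳ r p q)))
          (+P-interchange (scaleP a r) (scaleP b r) (+ 0 ∷ (p *P r)) (+ 0 ∷ (q *P r)))

*P-distribˡ : ∀ p q r → (p *P (q +P r)) ≋ ((p *P q) +P (p *P r))
*P-distribˡ p q r =
  ≋-trans (*P-comm p (q +P r)) (≋-trans (*P-distribʳ p q r) (+P-cong (*P-comm q p) (*P-comm r p)))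

0∷-*P : ∀ p q → ((+ 0 ∷ p) *P q) ≋ (+ 0 ∷ (p *P q))
0∷-*P p q = +P-cong (scaleP-zero q) ≋-refl

scaleP-*P : ∀ a p q → (scaleP a p *P q) ≋ scaleP a (p *P q)
scaleP-*P a []      q = ≋-refl
scaleP-*P a (b ∷ p) q =
  ≋-trans (+P-cong (≋-sym (scaleP-assoc a b q)) (∷-cong (sym (ℤ.*-zeroʳ a)) (scaleP-*P a p q)))
          (≋-sym (scaleP-distribˡ a (scaleP b q) (+ 0 ∷ (p *P q))))

*P-assoc : ∀ p q r → ((p *P q) *P r) ≋ (p *P (q *P r))
*P-assoc []      q r = ≋-refl
*P-assoc (a ∷ p) q r = ≋-trans (*P-distribʳ r (scaleP a q) (+ 0 ∷ (p *P q)))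
  (+P-cong (scaleP-*P a q r) (≋-trans (0∷-*P (p *P q) r) (∷-cong refl (*P-assoc p q r))))

1P : Poly
1P = constP (+ 1)

*P-identityˡ : ∀ p → (1P *P p) ≋ p
*P-identityˡ p = ≋-trans (+P-cong (scaleP-identity p) (0∷-≋[] ≋-refl)) (+P-identityʳ p)

*P-identityʳ : ∀ p → (p *P 1P) ≋ p
*P-identityʳ p = ≋-trans (*P-comm p 1P) (*P-identityˡ p)

Poly-commutativeRing : CommutativeRing 0ℓ 0ℓ
Poly-commutativeRing = record
  { Carrier = Poly ; _≈_ = _≋_ ; _+_ = _+P_ ; _*_ = _*P_ ; -_ = -P_ ; 0# = [] ; 1# = 1P
  ; isCommutativeRing = record
    { isRing = record
      { +-isAbelianGroup = record
        { isGroup = record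
          { isMonoid = record
            { isSemigroup = record
              { isMagma = record
                { isEquivalence = record { refl = ≋-refl ; sym = ≋-sym ; trans = ≋-trans }
                ; ∙-cong = +P-cong }
              ; assoc = +P-assoc }
            ; identity = +P-identityˡ , +P-identityʳ }
          ; inverse = (λ p → ≋-trans (+P-comm (-P p) p) (+P-inverseʳ p)) , +P-inverseʳ
          ; ⁻¹-cong = -P-cong }
        ; comm = +P-comm }
      ; *-cong = *P-cong
      ; *-assoc = *P-assoc
      ; *-identity = *P-identityˡ , *P-identityʳ
      ; distrib = *P-distribˡ , *P-distribʳ }
    ; *-comm = *P-comm } }

[]≋? : ∀ p → Maybe ([] ≋ p)
[]≋? []      = just ≋-refl
[]≋? (a ∷ p) with a ℤ.≟ + 0 | []≋? p
... | yes a≡0 | just []≋p = just (≋-sym (≋-trans (∷-cong a≡0 (≋-sym []≋p)) (0∷-≋[] ≋-refl)))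
... | _       | _         = nothing

Poly-ring : AlmostCommutativeRing 0ℓ 0ℓ
Poly-ring = fromCommutativeRing Poly-commutativeRing []≋?

module PolyReasoning = SetoidReasoning (CommutativeRing.setoid Poly-commutativeRing)

Nonzero : Poly → Set
Nonzero p = ¬ p ≋ []

1P-nonzero : Nonzero 1P
1P-nonzero h with coeff-≡ h 0
... | ()

scaleP0-+P-0∷-≋[] : ∀ {a} p q → a ≡ + 0 → (scaleP a p +P (+ 0 ∷ q)) ≋ [] → q ≋ []
scaleP0-+P-0∷-≋[] p q refl h = tail-≋[] (≋-trans (≋-sym (+P-cong (scaleP-zero p) (≋-refl {+ 0 ∷ q}))) h)

-- Compare constant terms: b * a = 0 with a ≠ 0 forces b = 0, and the rest of the product is shifted by t.
∷-*P-noZeroDivisors : ∀ {a} d x → a ≢ + 0 → ((a ∷ d) *P x) ≋ [] → x ≋ []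
∷-*P-noZeroDivisors d []      a≢0 h = ≋-refl
∷-*P-noZeroDivisors {a} d (b ∷ x) a≢0 h =
  ≋-trans (∷-cong b≡0 (∷-*P-noZeroDivisors d x a≢0 (scaleP0-+P-0∷-≋[] (a ∷ d) _ b≡0 split))) (0∷-≋[] ≋-refl)
  where
  split : (scaleP b (a ∷ d) +P (+ 0 ∷ ((a ∷ d) *P x))) ≋ []
  split = ≋-trans (≋-sym (*P-∷ʳ (a ∷ d) b x)) h
  b≡0 : b ≡ + 0
  b≡0 with ℤ.i*j≡0⇒i≡0∨j≡0 b (trans (sym (ℤ.+-identityʳ (b * a))) (coeff-≡ split 0))
  ... | inj₁ b≡0 = b≡0
  ... | inj₂ a≡0 = ⊥-elim (a≢0 a≡0)

*P-noZeroDivisors : ∀ d x → .(Nonzero d) → (d *P x) ≋ [] → x ≋ []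
*P-noZeroDivisors []      x d≉0 h = ⊥-elim-irr (d≉0 ≋-refl)
*P-noZeroDivisors (a ∷ d) x d≉0 h with a ℤ.≟ + 0
... | no  a≢0 = ∷-*P-noZeroDivisors d x a≢0 h
... | yes a≡0 = *P-noZeroDivisors d x (λ d≋[] → d≉0 (≋-trans (∷-cong a≡0 d≋[]) (0∷-≋[] ≋-refl)))
  (scaleP0-+P-0∷-≋[] x (d *P x) a≡0 h)

*P-nonzero : ∀ {d e} → .(Nonzero d) → .(Nonzero e) → Nonzero (d *P e)
*P-nonzero {d} {e} d≉0 e≉0 de≋[] = ⊥-elim-irr (e≉0 (*P-noZeroDivisors d e d≉0 de≋[]))

≋-from-difference : ∀ p q → (p +P (-P q)) ≋ [] → p ≋ q
≋-from-difference p q h = ≋-trans (split p q) (≋-trans (+P-cong h ≋-refl) (+P-identityˡ q))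
  where
  split : ∀ p q → p ≋ ((p +P (-P q)) +P q)
  split = solve-∀ Poly-ring

*P-cancelˡ : ∀ c p q → .(Nonzero c) → (c *P p) ≋ (c *P q) → p ≋ q
*P-cancelˡ c p q c≉0 h = ≋-from-difference p q (*P-noZeroDivisors c _ c≉0
  (≋-trans (factor c p q) (≋-trans (+P-cong h ≋-refl) (+P-inverseʳ (c *P q)))))
  where
  factor : ∀ c p q → (c *P (p +P (-P q))) ≋ ((c *P p) +P (-P (c *P q)))
  factor = solve-∀ Poly-ring

-- Rational functions with nonzero denominator

record Frac : Set where
  constructor frac
  field
    val          : RatFun
    .den-nonzero : Nonzero (den val)
open Frac

numF denF : Frac → Poly
numF x = num (val x)
denF x = den (val x)

infix 4 _≃_
record _≃_ (x y : Frac) : Set where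
  constructor mk≃
  field cross-≋ : (numF x *P denF y) ≋ (numF y *P denF x)
open _≃_

infixl 6 _+F_ _-F_
infixl 7 _*F_

_+F_ : Frac → Frac → Frac
frac x x≉0 +F frac y y≉0 = frac (x +ᵣ y) (*P-nonzero x≉0 y≉0)

_*F_ : Frac → Frac → Frac
frac x x≉0 *F frac y y≉0 = frac (x *ᵣ y) (*P-nonzero x≉0 y≉0)

-F_ : Frac → Frac
-F frac x x≉0 = frac (-ᵣ x) x≉0

_-F_ : Frac → Frac → Frac
x -F y = x +F (-F y)

0F 1F : Frac
0F = frac 0ᵣ 1P-nonzero
1F = frac 1ᵣ 1P-nonzero

≡⇒≃ : ∀ {x y} → x ≡ y → x ≃ y
≡⇒≃ refl = mk≃ ≋-refl

≃-refl : ∀ {x} → x ≃ x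
≃-refl = mk≃ ≋-refl

≃-sym : ∀ {x y} → x ≃ y → y ≃ x
≃-sym h = mk≃ (≋-sym (cross-≋ h))

-- Transitivity cancels the denominator of y; this is why Frac carries a nonzero-denominator proof.
≃-trans : ∀ {x y z} → x ≃ y → y ≃ z → x ≃ z
≃-trans {x} {y@(frac _ y≉0)} {z} x≃y y≃z = mk≃ (*P-cancelˡ (denF y) _ _ y≉0 (begin
  denF y *P (numF x *P denF z)   ≈⟨ rearrange (denF y) (numF x) (denF z) ⟩
  (numF x *P denF y) *P denF z   ≈⟨ *P-congˡ (denF z) (cross-≋ x≃y) ⟩
  (numF y *P denF x) *P denF z   ≈⟨ swap (numF y) (denF x) (denF z) ⟩
  (numF y *P denF z) *P denF x   ≈⟨ *P-congˡ (denF x) (cross-≋ y≃z) ⟩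
  (numF z *P denF y) *P denF x   ≈⟨ ≋-sym (rearrange (denF y) (numF z) (denF x)) ⟩
  denF y *P (numF z *P denF x)   ∎))
  where
  open PolyReasoning
  rearrange : ∀ a b c → (a *P (b *P c)) ≋ ((b *P a) *P c)
  rearrange = solve-∀ Poly-ring
  swap : ∀ a b c → ((a *P b) *P c) ≋ ((a *P c) *P b)
  swap = solve-∀ Poly-ring

+F-cong : ∀ {x x′ y y′} → x ≃ x′ → y ≃ y′ → x +F y ≃ x′ +F y′
+F-cong {x} {x′} {y} {y′} x≃x′ y≃y′ = mk≃ (begin
  (nx *P dy +P ny *P dx) *P (dx′ *P dy′)
    ≈⟨ expand nx dx ny dy dx′ dy′ ⟩
  (nx *P dx′) *P (dy *P dy′) +P (ny *P dy′) *P (dx *P dx′)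
    ≈⟨ +P-cong (*P-congˡ _ (cross-≋ x≃x′)) (*P-congˡ _ (cross-≋ y≃y′)) ⟩
  (nx′ *P dx) *P (dy *P dy′) +P (ny′ *P dy) *P (dx *P dx′)
    ≈⟨ collect nx′ dx′ ny′ dy′ dx dy ⟩
  (nx′ *P dy′ +P ny′ *P dx′) *P (dx *P dy)   ∎)
  where
  open PolyReasoning
  nx = numF x ; dx = denF x ; ny = numF y ; dy = denF y
  nx′ = numF x′ ; dx′ = denF x′ ; ny′ = numF y′ ; dy′ = denF y′
  expand : ∀ a da b db dc dd →
    ((a *P db +P b *P da) *P (dc *P dd)) ≋ ((a *P dc) *P (db *P dd) +P (b *P dd) *P (da *P dc))
  expand = solve-∀ Poly-ring
  collect : ∀ a da b db dc dd →
    ((a *P dc) *P (dd *P db) +P (b *P dd) *P (dc *P da)) ≋ ((a *P db +P b *P da) *P (dc *P dd))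
  collect = solve-∀ Poly-ring

*F-cong : ∀ {x x′ y y′} → x ≃ x′ → y ≃ y′ → x *F y ≃ x′ *F y′
*F-cong {x} {x′} {y} {y′} x≃x′ y≃y′ = mk≃ (begin
  (nx *P ny) *P (dx′ *P dy′)    ≈⟨ interchange nx ny dx′ dy′ ⟩
  (nx *P dx′) *P (ny *P dy′)    ≈⟨ *P-cong (cross-≋ x≃x′) (cross-≋ y≃y′) ⟩
  (nx′ *P dx) *P (ny′ *P dy)    ≈⟨ interchange nx′ dx ny′ dy ⟩
  (nx′ *P ny′) *P (dx *P dy)    ∎)
  where
  open PolyReasoning
  nx = numF x ; dx = denF x ; ny = numF y ; dy = denF y
  nx′ = numF x′ ; dx′ = denF x′ ; ny′ = numF y′ ; dy′ = denF y′
  interchange : ∀ a b c d → ((a *P b) *P (c *P d)) ≋ ((a *P c) *P (b *P d))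
  interchange = solve-∀ Poly-ring

-F-cong : ∀ {x x′} → x ≃ x′ → -F x ≃ -F x′
-F-cong {x} {x′} x≃x′ = mk≃ (begin
  (-P numF x) *P denF x′    ≈⟨ -P-*P (numF x) (denF x′) ⟩
  -P (numF x *P denF x′)    ≈⟨ -P-cong (cross-≋ x≃x′) ⟩
  -P (numF x′ *P denF x)    ≈⟨ ≋-sym (-P-*P (numF x′) (denF x)) ⟩
  (-P numF x′) *P denF x    ∎)
  where
  open PolyReasoning
  -P-*P : ∀ a b → ((-P a) *P b) ≋ (-P (a *P b))
  -P-*P = solve-∀ Poly-ring

+F-assoc : ∀ x y z → (x +F y) +F z ≃ x +F (y +F z)
+F-assoc x y z = mk≃ (law (numF x) (denF x) (numF y) (denF y) (numF z) (denF z))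
  where
  law : ∀ a da b db c dc →
    ((a *P db +P b *P da) *P dc +P c *P (da *P db)) *P (da *P (db *P dc))
      ≋ (a *P (db *P dc) +P (b *P dc +P c *P db) *P da) *P ((da *P db) *P dc)
  law = solve-∀ Poly-ring

+F-comm : ∀ x y → x +F y ≃ y +F x
+F-comm x y = mk≃ (law (numF x) (denF x) (numF y) (denF y))
  where
  law : ∀ a da b db → ((a *P db +P b *P da) *P (db *P da)) ≋ ((b *P da +P a *P db) *P (da *P db))
  law = solve-∀ Poly-ring

+F-identityˡ : ∀ x → 0F +F x ≃ x
+F-identityˡ x = mk≃ (law (numF x) (denF x))
  where
  law : ∀ a da → (([] *P da +P a *P 1P) *P da) ≋ (a *P (1P *P da))
  law = solve-∀ Poly-ring

+F-identityʳ : ∀ x → x +F 0F ≃ x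
+F-identityʳ x = ≃-trans (+F-comm x 0F) (+F-identityˡ x)

+F-inverseˡ : ∀ x → (-F x) +F x ≃ 0F
+F-inverseˡ x = mk≃ (law (numF x) (denF x))
  where
  law : ∀ a da → (((-P a) *P da +P a *P da) *P 1P) ≋ ([] *P (da *P da))
  law = solve-∀ Poly-ring

+F-inverseʳ : ∀ x → x +F (-F x) ≃ 0F
+F-inverseʳ x = ≃-trans (+F-comm x (-F x)) (+F-inverseˡ x)

*F-assoc : ∀ x y z → (x *F y) *F z ≃ x *F (y *F z)
*F-assoc x y z = mk≃ (law (numF x) (denF x) (numF y) (denF y) (numF z) (denF z))
  where
  law : ∀ a da b db c dc → (((a *P b) *P c) *P (da *P (db *P dc))) ≋ ((a *P (b *P c)) *P ((da *P db) *P dc))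
  law = solve-∀ Poly-ring

*F-comm : ∀ x y → x *F y ≃ y *F x
*F-comm x y = mk≃ (law (numF x) (denF x) (numF y) (denF y))
  where
  law : ∀ a da b db → ((a *P b) *P (db *P da)) ≋ ((b *P a) *P (da *P db))
  law = solve-∀ Poly-ring

*F-identityˡ : ∀ x → 1F *F x ≃ x
*F-identityˡ x = mk≃ (law (numF x) (denF x))
  where
  law : ∀ a da → ((1P *P a) *P da) ≋ (a *P (1P *P da))
  law = solve-∀ Poly-ring

*F-identityʳ : ∀ x → x *F 1F ≃ x
*F-identityʳ x = ≃-trans (*F-comm x 1F) (*F-identityˡ x)

*F-distribˡ : ∀ x y z → x *F (y +F z) ≃ x *F y +F x *F z
*F-distribˡ x y z = mk≃ (law (numF x) (denF x) (numF y) (denF y) (numF z) (denF z))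
  where
  law : ∀ a da b db c dc →
    ((a *P (b *P dc +P c *P db)) *P ((da *P db) *P (da *P dc)))
      ≋ (((a *P b) *P (da *P dc) +P (a *P c) *P (da *P db)) *P (da *P (db *P dc)))
  law = solve-∀ Poly-ring

*F-distribʳ : ∀ x y z → (y +F z) *F x ≃ y *F x +F z *F x
*F-distribʳ x y z =
  ≃-trans (*F-comm (y +F z) x) (≃-trans (*F-distribˡ x y z) (+F-cong (*F-comm x y) (*F-comm x z)))

Frac-commutativeRing : CommutativeRing 0ℓ 0ℓ
Frac-commutativeRing = record
  { Carrier = Frac ; _≈_ = _≃_ ; _+_ = _+F_ ; _*_ = _*F_ ; -_ = -F_ ; 0# = 0F ; 1# = 1F
  ; isCommutativeRing = record
    { isRing = record
      { +-isAbelianGroup = record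
        { isGroup = record
          { isMonoid = record
            { isSemigroup = record
              { isMagma = record
                { isEquivalence = record { refl = ≃-refl ; sym = ≃-sym ; trans = ≃-trans }
                ; ∙-cong = +F-cong }
              ; assoc = +F-assoc }
            ; identity = +F-identityˡ , +F-identityʳ }
          ; inverse = +F-inverseˡ , +F-inverseʳ
          ; ⁻¹-cong = -F-cong }
        ; comm = +F-comm }
      ; *-cong = *F-cong
      ; *-assoc = *F-assoc
      ; *-identity = *F-identityˡ , *F-identityʳ
      ; distrib = *F-distribˡ , *F-distribʳ }
    ; *-comm = *F-comm } }

0F≃? : ∀ x → Maybe (0F ≃ x)
0F≃? x with []≋? (numF x)
... | just []≋num = just (mk≃ (≋-trans []≋num (≋-sym (*P-identityʳ (numF x)))))
... | nothing     = nothing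

Frac-ring : AlmostCommutativeRing 0ℓ 0ℓ
Frac-ring = fromCommutativeRing Frac-commutativeRing 0F≃?

module FracReasoning = SetoidReasoning (CommutativeRing.setoid Frac-commutativeRing)

-- Powers of t

XP-+ : ∀ a b → (XP a *P XP b) ≋ XP (a ℕ.+ b)
XP-+ zero    b = *P-identityˡ (XP b)
XP-+ (suc a) b = ≋-trans (0∷-*P (XP a) (XP b)) (∷-cong refl (XP-+ a b))

XP-nonzero : ∀ k → Nonzero (XP k)
XP-nonzero zero    h with coeff-≡ h 0
... | ()
XP-nonzero (suc k) h = XP-nonzero k (tail-≋[] h)

tpow-den-nonzero : ∀ e → Nonzero (den (tpow e))
tpow-den-nonzero (+ k)    = 1P-nonzero
tpow-den-nonzero -[1+ k ] = XP-nonzero (suc k)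

t^_ : ℤ → Frac
t^ e = frac (tpow e) (tpow-den-nonzero e)

t^[_-_] : ℕ → ℕ → Frac
t^[ a - b ] = frac (XP a /ᵣ XP b) (XP-nonzero b)

t^≃t^[-] : ∀ e a b → + a ≡ e + + b → t^ e ≃ t^[ a - b ]
t^≃t^[-] (+ k) a b a≡k+b = mk≃ (≋-trans (XP-+ k b)
  (≋-trans (≡⇒≋ (cong XP (sym (ℤ.+-injective a≡k+b)))) (≋-sym (*P-identityʳ (XP a)))))
t^≃t^[-] -[1+ k ] a b a≡e+b = mk≃ (≋-trans (*P-identityˡ (XP b))
  (≋-sym (≋-trans (XP-+ a (suc k)) (≡⇒≋ (cong XP (ℤ.+-injective a+k≡b))))))
  where
  cancel : ∀ x y → (- x + y) + x ≡ y
  cancel = ℤ-solve-∀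
  a+k≡b : + (a ℕ.+ suc k) ≡ + b
  a+k≡b = trans (cong (_+ + suc k) a≡e+b) (cancel (+ suc k) (+ b))

as-ℕ-difference : ∀ e → ∃₂ λ a b → + a ≡ e + + b
as-ℕ-difference (+ k)    = k , 0 , sym (ℤ.+-identityʳ (+ k))
as-ℕ-difference -[1+ k ] = 0 , suc k , sym (ℤ.+-inverseˡ (+ suc k))

t^[-]-*F : ∀ a b c d → t^[ a - b ] *F t^[ c - d ] ≃ t^[ a ℕ.+ c - b ℕ.+ d ]
t^[-]-*F a b c d = mk≃ (*P-cong (XP-+ a c) (≋-sym (XP-+ b d)))

t^-+ : ∀ e f → t^ e *F t^ f ≃ t^ (e + f)
t^-+ e f with as-ℕ-difference e | as-ℕ-difference f
... | a , b , a≡e+b | c , d , c≡f+d = begin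
  t^ e *F t^ f                ≈⟨ *F-cong (t^≃t^[-] e a b a≡e+b) (t^≃t^[-] f c d c≡f+d) ⟩
  t^[ a - b ] *F t^[ c - d ]  ≈⟨ t^[-]-*F a b c d ⟩
  t^[ a ℕ.+ c - b ℕ.+ d ]     ≈⟨ ≃-sym (t^≃t^[-] (e + f) (a ℕ.+ c) (b ℕ.+ d) a+c≡e+f+b+d) ⟩
  t^ (e + f)                  ∎
  where
  open FracReasoning
  regroup : ∀ e f b d → (e + b) + (f + d) ≡ (e + f) + (b + d)
  regroup = ℤ-solve-∀
  a+c≡e+f+b+d : + (a ℕ.+ c) ≡ (e + f) + + (b ℕ.+ d)
  a+c≡e+f+b+d = trans (cong₂ _+_ a≡e+b c≡f+d) (regroup e f (+ b) (+ d))

-- Finite sums and products, division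

sumᵣ-den-nonzero : ∀ k (F : ℕ → Frac) → Nonzero (den (sumᵣ k (val ∘ F)))
sumᵣ-den-nonzero zero    F = 1P-nonzero
sumᵣ-den-nonzero (suc k) F with F k
... | frac _ Fk≉0 = *P-nonzero (sumᵣ-den-nonzero k F) Fk≉0

prodᵣ-den-nonzero : ∀ k (F : ℕ → Frac) → Nonzero (den (prodᵣ k (val ∘ F)))
prodᵣ-den-nonzero zero    F = 1P-nonzero
prodᵣ-den-nonzero (suc k) F with F k
... | frac _ Fk≉0 = *P-nonzero (prodᵣ-den-nonzero k F) Fk≉0

sumF prodF : ℕ → (ℕ → Frac) → Frac
sumF  k F = frac (sumᵣ k (val ∘ F)) (sumᵣ-den-nonzero k F)
prodF k F = frac (prodᵣ k (val ∘ F)) (prodᵣ-den-nonzero k F)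

sumF-cong : ∀ k {F G : ℕ → Frac} → (∀ i → F i ≃ G i) → sumF k F ≃ sumF k G
sumF-cong zero    F≃G = ≃-refl
sumF-cong (suc k) F≃G = +F-cong (sumF-cong k F≃G) (F≃G k)

prodF-cong : ∀ k {F G : ℕ → Frac} → (∀ i → F i ≃ G i) → prodF k F ≃ prodF k G
prodF-cong zero    F≃G = ≃-refl
prodF-cong (suc k) F≃G = *F-cong (prodF-cong k F≃G) (F≃G k)

sumF-+F : ∀ k (F G : ℕ → Frac) → sumF k (λ i → F i +F G i) ≃ sumF k F +F sumF k G
sumF-+F zero    F G = ≃-sym (+F-identityˡ 0F)
sumF-+F (suc k) F G =
  ≃-trans (+F-cong (sumF-+F k F G) (≃-refl {F k +F G k})) (interchange (sumF k F) (sumF k G) (F k) (G k))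
  where
  interchange : ∀ a b c d → (a +F b) +F (c +F d) ≃ (a +F c) +F (b +F d)
  interchange = solve-∀ Frac-ring

sumF-suc : ∀ k (F : ℕ → Frac) → sumF (suc k) F ≃ F 0 +F sumF k (F ∘ suc)
sumF-suc zero    F = +F-comm 0F (F 0)
sumF-suc (suc k) F =
  ≃-trans (+F-cong (sumF-suc k F) (≃-refl {F (suc k)})) (+F-assoc (F 0) (sumF k (F ∘ suc)) (F (suc k)))

*F-distribˡ-sumF : ∀ k c (F : ℕ → Frac) → c *F sumF k F ≃ sumF k (λ i → c *F F i)
*F-distribˡ-sumF zero    c F = zeroʳ c
  where
  zeroʳ : ∀ c → c *F 0F ≃ 0F
  zeroʳ = solve-∀ Frac-ring
*F-distribˡ-sumF (suc k) c F =
  ≃-trans (*F-distribˡ c (sumF k F) (F k)) (+F-cong (*F-distribˡ-sumF k c F) (≃-refl {c *F F k}))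

divF : (x y : Frac) → .(Nonzero (numF y)) → Frac
divF (frac x x≉0) y y≉0 = frac (x ÷ᵣ val y) (*P-nonzero x≉0 y≉0)

divF-*F : ∀ x y y≉0 → divF x y y≉0 *F y ≃ x
divF-*F x y y≉0 = mk≃ (law (numF x) (denF x) (numF y) (denF y))
  where
  law : ∀ a da b db → (((a *P db) *P b) *P da) ≋ (a *P ((da *P b) *P db))
  law = solve-∀ Poly-ring

*F-cancelʳ : ∀ x y z → .(Nonzero (numF z)) → x *F z ≃ y *F z → x ≃ y
*F-cancelʳ x y z@(frac _ dz≉0) nz≉0 xz≃yz =
  mk≃ (*P-cancelˡ (nz *P dz) _ _ (*P-nonzero nz≉0 dz≉0) (begin
    (nz *P dz) *P (numF x *P denF y)       ≈⟨ regroup (numF x) nz dz (denF y) ⟩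
    (numF x *P nz) *P (denF y *P dz)       ≈⟨ cross-≋ xz≃yz ⟩
    (numF y *P nz) *P (denF x *P dz)       ≈⟨ ≋-sym (regroup (numF y) nz dz (denF x)) ⟩
    (nz *P dz) *P (numF y *P denF x)       ∎))
  where
  open PolyReasoning
  nz = numF z ; dz = denF z
  regroup : ∀ a c dc db → ((c *P dc) *P (a *P db)) ≋ ((a *P c) *P (db *P dc))
  regroup = solve-∀ Poly-ring

-- t-Pochhammer symbols and t-binomial coefficients

1-t^_ : ℤ → Frac
1-t^ e = 1F -F t^ e

tPochF : ℤ → ℕ → Frac
tPochF a k = prodF k (λ i → 1-t^ (a + + i))

tPochF-1-nonzero : ∀ m → Nonzero (numF (tPochF (+ 1) m))
tPochF-1-nonzero zero    = 1P-nonzero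
tPochF-1-nonzero (suc m) = *P-nonzero (tPochF-1-nonzero m) 1-t^suc-nonzero
  where
  1-t^suc-nonzero : Nonzero (numF (1-t^ (+ suc m)))
  1-t^suc-nonzero h with coeff-≡ h 0
  ... | ()

tBinomF : ℤ → ℕ → Frac
tBinomF N m = divF (prodF m (λ i → 1-t^ (N - + m + + suc i))) (tPochF (+ 1) m) (tPochF-1-nonzero m)

tPochF-suc : ∀ a k → tPochF a (suc k) ≃ 1-t^ a *F tPochF (a + + 1) k
tPochF-suc a zero    =
  ≃-trans (*F-comm 1F (1-t^ (a + + 0))) (≡⇒≃ (cong (λ e → 1-t^ e *F 1F) (ℤ.+-identityʳ a)))
tPochF-suc a (suc k) = ≃-trans (*F-cong (tPochF-suc a k) (≡⇒≃ (cong 1-t^_ (shift a (+ k)))))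
                               (*F-assoc (1-t^ a) (tPochF (a + + 1) k) (1-t^ (a + + 1 + + k)))
  where
  shift : ∀ a k → a + (+ 1 + k) ≡ a + + 1 + k
  shift = ℤ-solve-∀

tBinomF-*F-tPochF : ∀ N m a → N - + m + + 1 ≡ a → tBinomF N m *F tPochF (+ 1) m ≃ tPochF a m
tBinomF-*F-tPochF N m a base≡a = ≃-trans (divF-*F _ (tPochF (+ 1) m) (tPochF-1-nonzero m))
  (prodF-cong m λ i → ≡⇒≃ (cong 1-t^_ (trans (shift (N - + m) (+ i)) (cong (_+ + i) base≡a))))
  where
  shift : ∀ b i → b + (+ 1 + i) ≡ b + + 1 + i
  shift = ℤ-solve-∀

1-t^-split : ∀ c k → t^ c *F 1-t^ (+ suc k) +F 1-t^ c ≃ 1-t^ (c + + 1 + + k)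
1-t^-split c k = begin
  t^ c *F 1-t^ (+ suc k) +F 1-t^ c   ≈⟨ expand (t^ c) (t^ (+ suc k)) ⟩
  1F -F t^ c *F t^ (+ suc k)         ≈⟨ +F-cong (≃-refl {1F}) (-F-cong (t^-+ c (+ suc k))) ⟩
  1F -F t^ (c + + suc k)             ≈⟨ ≡⇒≃ (cong 1-t^_ (shift c (+ k))) ⟩
  1-t^ (c + + 1 + + k)               ∎
  where
  open FracReasoning
  expand : ∀ x y → x *F (1F -F y) +F (1F -F x) ≃ 1F -F x *F y
  expand = solve-∀ Frac-ring
  shift : ∀ c k → c + (+ 1 + k) ≡ c + + 1 + k
  shift = ℤ-solve-∀

tBinomF-pascal : ∀ N m → tBinomF (+ 1 + N) (suc m) ≃ t^ (N - + m) *F tBinomF N m +F tBinomF N (suc m)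
tBinomF-pascal N m = ≃-sym (*F-cancelʳ _ _ (tPochF (+ 1) (suc m)) (tPochF-1-nonzero (suc m)) (begin
  (t^ c *F tBinomF N m +F tBinomF N (suc m)) *F ([m]! *F 1-t^ (+ suc m))
    ≈⟨ distribute (t^ c) (tBinomF N m) (tBinomF N (suc m)) [m]! (1-t^ (+ suc m)) ⟩
  (t^ c *F 1-t^ (+ suc m)) *F (tBinomF N m *F [m]!) +F tBinomF N (suc m) *F ([m]! *F 1-t^ (+ suc m))
    ≈⟨ +F-cong (*F-cong (≃-refl {t^ c *F 1-t^ (+ suc m)}) (tBinomF-*F-tPochF N m (c + + 1) refl))
               (≃-trans (tBinomF-*F-tPochF N (suc m) c (unshift N (+ m))) (tPochF-suc c m)) ⟩
  (t^ c *F 1-t^ (+ suc m)) *F tPochF (c + + 1) m +F 1-t^ c *F tPochF (c + + 1) m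
    ≈⟨ factor (t^ c *F 1-t^ (+ suc m)) (1-t^ c) (tPochF (c + + 1) m) ⟩
  tPochF (c + + 1) m *F (t^ c *F 1-t^ (+ suc m) +F 1-t^ c)
    ≈⟨ *F-cong (≃-refl {tPochF (c + + 1) m}) (1-t^-split c m) ⟩
  tPochF (c + + 1) (suc m)
    ≈⟨ ≃-sym (tBinomF-*F-tPochF (+ 1 + N) (suc m) (c + + 1) (shift N (+ m))) ⟩
  tBinomF (+ 1 + N) (suc m) *F ([m]! *F 1-t^ (+ suc m))   ∎))
  where
  open FracReasoning
  c = N - + m
  [m]! = tPochF (+ 1) m
  distribute : ∀ s b b′ p o → (s *F b +F b′) *F (p *F o) ≃ (s *F o) *F (b *F p) +F b′ *F (p *F o)
  distribute = solve-∀ Frac-ring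
  factor : ∀ x y z → x *F z +F y *F z ≃ z *F (x +F y)
  factor = solve-∀ Frac-ring
  unshift : ∀ N m → N - (+ 1 + m) + + 1 ≡ N - m
  unshift = ℤ-solve-∀
  shift : ∀ N m → + 1 + N - (+ 1 + m) + + 1 ≡ N - m + + 1
  shift = ℤ-solve-∀

-- t^ (+ 0) is definitionally 1F, so 1-t^ (+ 0) ≃ 0F is an instance of +F-inverseʳ.
tBinomF-suc-self : ∀ v → tBinomF (+ v) (suc v) ≃ 0F
tBinomF-suc-self v = *F-cancelʳ _ _ (tPochF (+ 1) (suc v)) (tPochF-1-nonzero (suc v)) (begin
  tBinomF (+ v) (suc v) *F tPochF (+ 1) (suc v)   ≈⟨ tBinomF-*F-tPochF (+ v) (suc v) (+ 0) (vanish (+ v)) ⟩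
  tPochF (+ 0) (suc v)                            ≈⟨ tPochF-suc (+ 0) v ⟩
  1-t^ (+ 0) *F tPochF (+ 1) v                    ≈⟨ *F-cong (+F-inverseʳ 1F) (≃-refl {tPochF (+ 1) v}) ⟩
  0F *F tPochF (+ 1) v                            ≈⟨ zeroˡ (tPochF (+ 1) v) (tPochF (+ 1) (suc v)) ⟩
  0F *F tPochF (+ 1) (suc v)                      ∎)
  where
  open FracReasoning
  vanish : ∀ v → v - (+ 1 + v) + + 1 ≡ + 0
  vanish = ℤ-solve-∀
  zeroˡ : ∀ x y → 0F *F x ≃ 0F *F y
  zeroˡ = solve-∀ Frac-ring

-- The normalised sum

module _ (l : ℕ) where

  poch : ℕ → Frac
  poch m = tPochF (+ 1 + + l - + m) m

  term α β α↑ : ℕ → ℕ → Frac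
  term v m = t^ ((+ l - + m) * (+ v - + m))     *F poch m       *F tBinomF (+ v) m
  α    v m = t^ ((+ l - + m) * (+ v - + m))     *F poch (suc m) *F tBinomF (+ v) m
  β    v m = t^ ((+ l - + m) * (+ suc v - + m)) *F poch m       *F tBinomF (+ v) m
  α↑ v zero    = 0F
  α↑ v (suc m) = α v m

  poch-suc : ∀ m → poch (suc m) ≃ 1-t^ (+ l - + m) *F poch m
  poch-suc m = ≃-trans (tPochF-suc (+ 1 + + l - + suc m) m)
    (≡⇒≃ (cong₂ (λ a b → 1-t^ a *F tPochF b m) (top (+ l) (+ m)) (base (+ l) (+ m))))
    where
    top : ∀ l m → + 1 + l - (+ 1 + m) ≡ l - m
    top = ℤ-solve-∀
    base : ∀ l m → + 1 + l - (+ 1 + m) + + 1 ≡ + 1 + l - m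
    base = ℤ-solve-∀

  term-suc≃α↑+β : ∀ v m → term (suc v) m ≃ α↑ v m +F β v m
  term-suc≃α↑+β v zero    = ≃-sym (+F-identityˡ (β v 0))
  term-suc≃α↑+β v (suc m) = begin
    t^ e *F poch (suc m) *F tBinomF (+ suc v) (suc m)
      ≈⟨ *F-cong (≃-refl {t^ e *F poch (suc m)}) (tBinomF-pascal (+ v) m) ⟩
    t^ e *F poch (suc m) *F (t^ (+ v - + m) *F tBinomF (+ v) m +F tBinomF (+ v) (suc m))
      ≈⟨ distribute (t^ e) (poch (suc m)) (t^ (+ v - + m)) (tBinomF (+ v) m) (tBinomF (+ v) (suc m)) ⟩
    t^ e *F t^ (+ v - + m) *F poch (suc m) *F tBinomF (+ v) m +F β v (suc m)
      ≈⟨ +F-cong (*F-cong (*F-cong (t^-+ e (+ v - + m)) (≃-refl {poch (suc m)})) (≃-refl {tBinomF (+ v) m}))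
                 (≃-refl {β v (suc m)}) ⟩
    t^ (e + (+ v - + m)) *F poch (suc m) *F tBinomF (+ v) m +F β v (suc m)
      ≈⟨ +F-cong (≡⇒≃ (cong (λ d → t^ d *F poch (suc m) *F tBinomF (+ v) m) (exponent (+ l) (+ v) (+ m))))
                 (≃-refl {β v (suc m)}) ⟩
    α v m +F β v (suc m)   ∎
    where
    open FracReasoning
    e = (+ l - + suc m) * (+ suc v - + suc m)
    distribute : ∀ x y s b b′ → x *F y *F (s *F b +F b′) ≃ x *F s *F y *F b +F x *F y *F b′
    distribute = solve-∀ Frac-ring
    exponent : ∀ l v m → (l - (+ 1 + m)) * ((+ 1 + v) - (+ 1 + m)) + (v - m) ≡ (l - m) * (v - m)
    exponent = ℤ-solve-∀

  α+β≃term : ∀ v m → α v m +F β v m ≃ term v m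
  α+β≃term v m = begin
    α v m +F β v m
      ≈⟨ +F-cong (*F-cong (*F-cong (≃-refl {t^ e}) (poch-suc m)) (≃-refl {tBinomF (+ v) m}))
                 (*F-cong (*F-cong t^-exponent (≃-refl {poch m})) (≃-refl {tBinomF (+ v) m})) ⟩
    t^ e *F (1-t^ (+ l - + m) *F poch m) *F tBinomF (+ v) m +F t^ e *F s *F poch m *F tBinomF (+ v) m
      ≈⟨ recombine (t^ e) s (poch m) (tBinomF (+ v) m) ⟩
    term v m   ∎
    where
    open FracReasoning
    e = (+ l - + m) * (+ v - + m)
    s = t^ (+ l - + m)
    recombine : ∀ x s p b → x *F ((1F -F s) *F p) *F b +F x *F s *F p *F b ≃ x *F p *F b
    recombine = solve-∀ Frac-ring
    exponent : ∀ l v m → (l - m) * ((+ 1 + v) - m) ≡ (l - m) * (v - m) + (l - m)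
    exponent = ℤ-solve-∀
    t^-exponent : t^ ((+ l - + m) * (+ suc v - + m)) ≃ t^ e *F s
    t^-exponent = ≃-trans (≡⇒≃ (cong t^_ (exponent (+ l) (+ v) (+ m)))) (≃-sym (t^-+ e (+ l - + m)))

  β-last≃0 : ∀ v → β v (suc v) ≃ 0F
  β-last≃0 v =
    ≃-trans (*F-cong (≃-refl {t^ e *F poch (suc v)}) (tBinomF-suc-self v)) (zeroʳ (t^ e *F poch (suc v)))
    where
    e = (+ l - + suc v) * (+ suc v - + suc v)
    zeroʳ : ∀ x → x *F 0F ≃ 0F
    zeroʳ = solve-∀ Frac-ring

  sum-term≃1 : ∀ v → sumF (suc v) (term v) ≃ 1F
  sum-term≃1 zero    = ≃-trans (+F-identityˡ (term 0 0))
    (≃-trans (≡⇒≃ (cong (λ e → t^ e *F 1F *F tBinomF (+ 0) 0) (ℤ.*-zeroʳ (+ l - + 0)))) (mk≃ ≋-refl))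
  sum-term≃1 (suc v) = begin
    sumF (suc (suc v)) (term (suc v))
      ≈⟨ sumF-cong (suc (suc v)) (term-suc≃α↑+β v) ⟩
    sumF (suc (suc v)) (λ m → α↑ v m +F β v m)
      ≈⟨ sumF-+F (suc (suc v)) (α↑ v) (β v) ⟩
    sumF (suc (suc v)) (α↑ v) +F (sumF (suc v) (β v) +F β v (suc v))
      ≈⟨ +F-cong (sumF-suc (suc v) (α↑ v)) (+F-cong (≃-refl {sumF (suc v) (β v)}) (β-last≃0 v)) ⟩
    (0F +F sumF (suc v) (α v)) +F (sumF (suc v) (β v) +F 0F)
      ≈⟨ drop-0F (sumF (suc v) (α v)) (sumF (suc v) (β v)) ⟩
    sumF (suc v) (α v) +F sumF (suc v) (β v)
      ≈⟨ ≃-sym (sumF-+F (suc v) (α v) (β v)) ⟩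
    sumF (suc v) (λ m → α v m +F β v m)
      ≈⟨ sumF-cong (suc v) (α+β≃term v) ⟩
    sumF (suc v) (term v)
      ≈⟨ sum-term≃1 v ⟩
    1F   ∎
    where
    open FracReasoning
    drop-0F : ∀ a b → (0F +F a) +F (b +F 0F) ≃ a +F b
    drop-0F = solve-∀ Frac-ring

-- val (fTermF n l v m) is definitionally fTerm n l v m, and likewise val (sumF k F) is sumᵣ k (val ∘ F).
fTermF : ℕ → ℕ → ℕ → ℕ → Frac
fTermF n l v m = t^ (- ((+ m + + n) * (+ l + + v - + m + + n))) *F poch l m *F tBinomF (+ v) m

fTermF-factor : ∀ n l v m → fTermF n l v m ≃ t^ (- ((+ l + + n) * (+ v + + n))) *F term l v m
fTermF-factor n l v m = begin
  fTermF n l v m                ≈⟨ ≡⇒≃ (cong (λ d → t^ d *F P *F B) (sym (exponent (+ l) (+ v) (+ m) (+ n)))) ⟩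
  t^ (K + E) *F P *F B          ≈⟨ *F-cong (*F-cong (≃-sym (t^-+ K E)) (≃-refl {P})) (≃-refl {B}) ⟩
  t^ K *F t^ E *F P *F B        ≈⟨ reassoc (t^ K) (t^ E) P B ⟩
  t^ K *F (t^ E *F P *F B)      ∎
  where
  open FracReasoning
  K = - ((+ l + + n) * (+ v + + n))
  E = (+ l - + m) * (+ v - + m)
  P = poch l m
  B = tBinomF (+ v) m
  exponent : ∀ l v m n → - ((l + n) * (v + n)) + (l - m) * (v - m) ≡ - ((m + n) * (l + v - m + n))
  exponent = ℤ-solve-∀
  reassoc : ∀ a b c d → a *F b *F c *F d ≃ a *F (b *F c *F d)
  reassoc = solve-∀ Frac-ring

lemmaA1 : (n λ₁ ν₁ : ℕ) →
    f n λ₁ ν₁ ≈ tpow (- ((+ λ₁ + + n) * (+ ν₁ + + n)))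
lemmaA1 n l v = coeff-≡ (cross-≋ (begin
  sumF (suc v) (fTermF n l v)                ≈⟨ sumF-cong (suc v) (fTermF-factor n l v) ⟩
  sumF (suc v) (λ m → t^ K *F term l v m)    ≈⟨ ≃-sym (*F-distribˡ-sumF (suc v) (t^ K) (term l v)) ⟩
  t^ K *F sumF (suc v) (term l v)            ≈⟨ *F-cong (≃-refl {t^ K}) (sum-term≃1 l v) ⟩
  t^ K *F 1F                                 ≈⟨ *F-identityʳ (t^ K) ⟩
  t^ K                                       ∎))
  where
  open FracReasoning
  K = - ((+ l + + n) * (+ v + + n))
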